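{- For any chip configuration $\sigma$ on $K_n$, $m(\sigma)\le\nu(\sigma)$, where $m(\sigma)$ is the eventual period of $\sigma$ and $\nu(\sigma)=\#\{\sigma(v):v\in[n]\}$ is the number of distinct heights in $\sigma$.
   Context: Parallel chip-firing on $K_n$: a chip configuration is $\sigma:[n]\to\mathbb{Z}_{\ge0}$; let $r(\sigma)=\#\{v:\sigma(v)\ge n\}$ and $U\sigma(v)=\sigma(v)+r(\sigma)$ if $\sigma(v)\le n-1$, $U\sigma(v)=\sigma(v)-n+r(\sigma)$ if $\sigma(v)\ge n$. The eventual period $m(\sigma)$ is the least $m\ge1$ such that $U^{t+m}\sigma=U^t\sigma$ for all sufficiently large $t$. -}

module Defs where

open import Data.Nat using (ℕ; zero; suc; _+_; _∸_; _≤_; _<_; _≥_; _≤?_; _≟_)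
open import Data.Fin using (Fin)
open import Data.List using (List; length; filter; map; deduplicate)
open import Data.List using () renaming (allFin to allFinL)
open import Data.Product using (Σ; _×_; ∃)
open import Relation.Binary.PropositionalEquality using (_≡_)
open import Relation.Nullary using (yes; no)

Config : ℕ → Set
Config n = Fin n → ℕ

r : ∀ {n} → Config n → ℕ
r {n} σ = length (filter (λ v → n ≤? σ v) (allFinL n))

U : ∀ {n} → Config n → Config n
U {n} σ v with n ≤? σ v
... | yes _ = (σ v ∸ n) + r σ
... | no  _ = σ v + r σ

iter : ∀ {n} → ℕ → Config n → Config n
iter zero    σ = σ
iter (suc t) σ = U (iter t σ)

EventuallyPeriodicWith : ∀ {n} → Config n → ℕ → Set
EventuallyPeriodicWith σ m =
  ∃ λ t₀ → ∀ t → t₀ ≤ t → ∀ v → iter (t + m) σ v ≡ iter t σ v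

IsEventualPeriod : ∀ {n} → Config n → ℕ → Set
IsEventualPeriod σ m =
  (1 ≤ m) × EventuallyPeriodicWith σ m ×
  (∀ m′ → 1 ≤ m′ → EventuallyPeriodicWith σ m′ → m ≤ m′)

ν : ∀ {n} → Config n → ℕ
ν {n} σ = length (deduplicate _≟_ (map σ (allFinL n)))

module Submission where

-- Each step adds r to every height and removes N from the firing vertices, so
-- σₜ(v) ≡ σ(v) + Rₜ (mod N) with Rₜ independent of v, while the total number of
-- chips is conserved.  Heights of at least 2N strictly decrease until either every
-- vertex fires (a fixed point) or all heights are below 2N; from then on every
-- configuration lies in a window of width less than N.  Such a configuration is
-- determined by the σ-height of one of its minimal vertices: the residues fix all
-- heights relative to the minimum and conservation fixes the minimum.  Among ν + 1
-- consecutive configurations two minimal vertices share a σ-height, so the orbit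
-- repeats after at most ν steps.

open import Defs
open import Data.Nat using (ℕ; zero; suc; _+_; _*_; _∸_; _≤_; _<_; _≤?_; _<?_; _≟_; z≤n; s≤s; NonZero; >-nonZero⁻¹)
open import Data.Nat.Properties
open import Data.Nat.DivMod using (_%_; [m+kn]%n≡m%n; m<n⇒m%n≡m)
open import Data.Nat.Induction using (<-rec)
open import Data.Fin using (Fin; toℕ) renaming (zero to fzero; suc to fsuc)
import Data.Fin.Properties as Fin
open import Data.List using (List; tabulate; filter; length; map; deduplicate; lookup)
open import Data.List using () renaming (allFin to allFinL)
open import Data.List.Properties using (length-filter; length-tabulate; filter-notAll)
open import Data.List.Extrema.Nat using (argmin; f[argmin]≤f[xs])
open import Data.List.Membership.Propositional using (_∈_)
open import Data.List.Membership.Propositional.Properties using (∈-map⁺; ∈-allFin; ∈-deduplicate⁺)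
import Data.List.Relation.Unary.All as All
import Data.List.Relation.Unary.Any as Any
open import Data.List.Relation.Unary.Any.Properties using (lookup-index)
open import Data.Product using (∃; ∃₂; _×_; _,_; proj₁; proj₂)
open import Data.Sum using (_⊎_; inj₁; inj₂)
import Data.Sum as Sum
open import Function using (_∘_; id)
open import Level using (0ℓ)
open import Relation.Nullary using (Dec; yes; no; ¬_; contradiction)
open import Relation.Nullary.Decidable using (_×-dec_)
open import Relation.Unary using (Decidable)
open import Relation.Binary.Bundles using (Setoid)
open import Relation.Binary.PropositionalEquality
import Relation.Binary.Reasoning.Setoid as SetoidReasoning
open import Algebra.Properties.CommutativeSemigroup +-commutativeSemigroup
  using (interchange; xy∙z≈xz∙y)

∑ : ∀ {N} → (Fin N → ℕ) → ℕ
∑ {zero}  f = 0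
∑ {suc N} f = f fzero + ∑ (f ∘ fsuc)

∑-cong : ∀ {N} {f g : Fin N → ℕ} → f ≗ g → ∑ f ≡ ∑ g
∑-cong {zero}  f≗g = refl
∑-cong {suc N} f≗g = cong₂ _+_ (f≗g fzero) (∑-cong (f≗g ∘ fsuc))

∑-+ : ∀ {N} (f g : Fin N → ℕ) → ∑ (λ i → f i + g i) ≡ ∑ f + ∑ g
∑-+ {zero}  f g = refl
∑-+ {suc N} f g = trans (cong (f fzero + g fzero +_) (∑-+ (f ∘ fsuc) (g ∘ fsuc)))
                        (interchange (f fzero) (g fzero) (∑ (f ∘ fsuc)) (∑ (g ∘ fsuc)))

∑-*ʳ : ∀ {N} (f : Fin N → ℕ) c → ∑ (λ i → f i * c) ≡ ∑ f * c
∑-*ʳ {zero}  f c = refl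
∑-*ʳ {suc N} f c = trans (cong (f fzero * c +_) (∑-*ʳ (f ∘ fsuc) c))
                         (sym (*-distribʳ-+ c (f fzero) (∑ (f ∘ fsuc))))

∑-const : ∀ N c → ∑ {N} (λ _ → c) ≡ N * c
∑-const zero    c = refl
∑-const (suc N) c = cong (c +_) (∑-const N c)

∑-mono-≤ : ∀ {N} {f g : Fin N → ℕ} → (∀ i → f i ≤ g i) → ∑ f ≤ ∑ g
∑-mono-≤ {zero}  f≤g = z≤n
∑-mono-≤ {suc N} f≤g = +-mono-≤ (f≤g fzero) (∑-mono-≤ (f≤g ∘ fsuc))

∑-mono-< : ∀ {N} {f g : Fin N → ℕ} → (∀ i → f i ≤ g i) → ∀ j → f j < g j → ∑ f < ∑ g
∑-mono-< f≤g fzero    fj<gj = +-mono-<-≤ fj<gj (∑-mono-≤ (f≤g ∘ fsuc))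
∑-mono-< f≤g (fsuc j) fj<gj = +-mono-≤-< (f≤g fzero) (∑-mono-< (f≤g ∘ fsuc) j fj<gj)

indicator : ∀ {p} {P : Set p} → Dec P → ℕ
indicator (yes _) = 1
indicator (no _)  = 0

length-filter-tabulate : ∀ {a p} {A : Set a} {P : A → Set p} (P? : Decidable P) {K} (g : Fin K → A) →
                         length (filter P? (tabulate g)) ≡ ∑ (λ i → indicator (P? (g i)))
length-filter-tabulate P? {zero}  g = refl
length-filter-tabulate P? {suc K} g with P? (g fzero)
... | yes _ = cong suc (length-filter-tabulate P? (g ∘ fsuc))
... | no _  = length-filter-tabulate P? (g ∘ fsuc)

least : ∀ {p} {P : ℕ → Set p} → Decidable P → ∀ {m} → P m → ∃ λ k → P k × (∀ {j} → P j → k ≤ j)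
least {p} {P} P? {m} = <-rec (λ m → P m → Least) search m
  where
  Least : Set p
  Least = ∃ λ k → P k × (∀ {j} → P j → k ≤ j)
  search : ∀ m → (∀ {j} → j < m → P j → Least) → P m → Least
  search m below Pm with anyUpTo? P? m
  ... | yes (j , j<m , Pj) = below j<m Pj
  ... | no none            = m , Pm , λ {j} Pj → ≮⇒≥ (λ j<m → none (j , j<m , Pj))

-- Congruence modulo N, phrased without subtraction.
infix 4 _≡_mod_

_≡_mod_ : ℕ → ℕ → ℕ → Set
a ≡ b mod N = ∃₂ λ k l → a + k * N ≡ b + l * N

≡⇒≡-mod : ∀ {a b N} → a ≡ b → a ≡ b mod N
≡⇒≡-mod a≡b = 0 , 0 , cong (_+ 0) a≡b

≡-mod-sym : ∀ {a b N} → a ≡ b mod N → b ≡ a mod N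
≡-mod-sym (k , l , eq) = l , k , sym eq

≡-mod-trans : ∀ {a b c N} → a ≡ b mod N → b ≡ c mod N → a ≡ c mod N
≡-mod-trans {a} {b} {c} {N} (k , l , eq) (k′ , l′ , eq′) = k + k′ , l′ + l , (begin
  a + (k + k′) * N         ≡⟨ cong (a +_) (*-distribʳ-+ N k k′) ⟩
  a + (k * N + k′ * N)     ≡⟨ +-assoc a _ _ ⟨
  a + k * N + k′ * N       ≡⟨ cong (_+ k′ * N) eq ⟩
  b + l * N + k′ * N       ≡⟨ xy∙z≈xz∙y b _ _ ⟩
  b + k′ * N + l * N       ≡⟨ cong (_+ l * N) eq′ ⟩
  c + l′ * N + l * N       ≡⟨ +-assoc c _ _ ⟩
  c + (l′ * N + l * N)     ≡⟨ cong (c +_) (*-distribʳ-+ N l′ l) ⟨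
  c + (l′ + l) * N         ∎)
  where open ≡-Reasoning

≡-mod-setoid : ℕ → Setoid 0ℓ 0ℓ
≡-mod-setoid N = record
  { Carrier       = ℕ
  ; _≈_           = _≡_mod N
  ; isEquivalence = record { refl = ≡⇒≡-mod refl ; sym = ≡-mod-sym ; trans = ≡-mod-trans }
  }

module ≡-mod-Reasoning (N : ℕ) = SetoidReasoning (≡-mod-setoid N)

+-congʳ-≡-mod : ∀ {a b N} c → a ≡ b mod N → a + c ≡ b + c mod N
+-congʳ-≡-mod {a} {b} c (k , l , eq) =
  k , l , trans (xy∙z≈xz∙y a c _) (trans (cong (_+ c) eq) (xy∙z≈xz∙y b _ c))

+-congˡ-≡-mod : ∀ {a b N} c → a ≡ b mod N → c + a ≡ c + b mod N
+-congˡ-≡-mod {a} {b} {N} c a≡b = subst₂ (_≡_mod N) (+-comm a c) (+-comm b c) (+-congʳ-≡-mod c a≡b)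

+-cancelʳ-≡-mod : ∀ {a b N} c → a + c ≡ b + c mod N → a ≡ b mod N
+-cancelʳ-≡-mod {a} {b} c (k , l , eq) =
  k , l , +-cancelʳ-≡ c _ _ (trans (xy∙z≈xz∙y a _ c) (trans eq (xy∙z≈xz∙y b c _)))

≡-mod⇒≡ : ∀ {a b N} → a < N → b < N → a ≡ b mod N → a ≡ b
≡-mod⇒≡ {a} {b} {N@(suc _)} a<N b<N (k , l , eq) = begin
  a               ≡⟨ m<n⇒m%n≡m a<N ⟨
  a % N           ≡⟨ [m+kn]%n≡m%n a k N ⟨
  (a + k * N) % N ≡⟨ cong (_% N) eq ⟩
  (b + l * N) % N ≡⟨ [m+kn]%n≡m%n b l N ⟩
  b % N           ≡⟨ m<n⇒m%n≡m b<N ⟩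
  b               ∎
  where open ≡-Reasoning

excess : ℕ → ℕ → ℕ
excess B x = suc x ∸ B

excess-mono-≤ : ∀ {B a x} → a < x ⊎ a < B → excess B a ≤ excess B x
excess-mono-≤ {B}         (inj₁ a<x) = ∸-monoˡ-≤ B (m≤n⇒m≤1+n a<x)
excess-mono-≤ {B} {a} {x} (inj₂ a<B) = subst (_≤ excess B x) (sym (m≤n⇒m∸n≡0 a<B)) z≤n

excess-mono-< : ∀ {B a x} → a < x → B ≤ x → excess B a < excess B x
excess-mono-< {B} {a} {x} a<x B≤x with B ≤? suc a
... | yes B≤1+a = ∸-monoˡ-< (s≤s a<x) B≤1+a
... | no B≰1+a  = subst (_< excess B x) (sym (m≤n⇒m∸n≡0 (<⇒≤ (≰⇒> B≰1+a)))) (m<n⇒0<n∸m (s≤s B≤x))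

module _ {N : ℕ} where

  firing : Config N → Fin N → ℕ
  firing τ v = indicator (N ≤? τ v)

  r≡∑firing : (τ : Config N) → r τ ≡ ∑ (firing τ)
  r≡∑firing τ = length-filter-tabulate (λ v → N ≤? τ v) id

  r≤N : (τ : Config N) → r τ ≤ N
  r≤N τ = ≤-trans (length-filter (λ v → N ≤? τ v) (allFinL N)) (≤-reflexive (length-tabulate id))

  r<N : (τ : Config N) (v : Fin N) → τ v < N → r τ < N
  r<N τ v τv<N = subst (r τ <_) (length-tabulate id)
    (filter-notAll (λ w → N ≤? τ w) (allFinL N) (Any.map (λ { refl → <⇒≱ τv<N }) (∈-allFin v)))

  r-cong : {τ τ′ : Config N} → τ ≗ τ′ → r τ ≡ r τ′
  r-cong {τ} {τ′} τ≗τ′ = begin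
    r τ            ≡⟨ r≡∑firing τ ⟩
    ∑ (firing τ)   ≡⟨ ∑-cong (cong (λ x → indicator (N ≤? x)) ∘ τ≗τ′) ⟩
    ∑ (firing τ′)  ≡⟨ r≡∑firing τ′ ⟨
    r τ′           ∎
    where open ≡-Reasoning

  U-cong : {τ τ′ : Config N} → τ ≗ τ′ → U τ ≗ U τ′
  U-cong {τ} {τ′} τ≗τ′ v with N ≤? τ v | N ≤? τ′ v
  ... | yes _     | yes _     = cong₂ _+_ (cong (_∸ N) (τ≗τ′ v)) (r-cong τ≗τ′)
  ... | no _      | no _      = cong₂ _+_ (τ≗τ′ v) (r-cong τ≗τ′)
  ... | yes N≤τv  | no N≰τ′v  = contradiction (subst (N ≤_) (τ≗τ′ v) N≤τv) N≰τ′v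
  ... | no N≰τv   | yes N≤τ′v = contradiction (subst (N ≤_) (sym (τ≗τ′ v)) N≤τ′v) N≰τv

  U-firing : (τ : Config N) (v : Fin N) → U τ v + firing τ v * N ≡ τ v + r τ
  U-firing τ v with N ≤? τ v
  ... | yes N≤τv = begin
    τ v ∸ N + r τ + 1 * N  ≡⟨ cong (τ v ∸ N + r τ +_) (*-identityˡ N) ⟩
    τ v ∸ N + r τ + N      ≡⟨ xy∙z≈xz∙y (τ v ∸ N) (r τ) N ⟩
    τ v ∸ N + N + r τ      ≡⟨ cong (_+ r τ) (m∸n+n≡m N≤τv) ⟩
    τ v + r τ              ∎
    where open ≡-Reasoning
  ... | no _ = +-identityʳ (τ v + r τ)

  U-≡-mod : (τ : Config N) (v : Fin N) → U τ v ≡ τ v + r τ mod N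
  U-≡-mod τ v = firing τ v , 0 , trans (U-firing τ v) (sym (+-identityʳ (τ v + r τ)))

  ∑-U : (τ : Config N) → ∑ (U τ) ≡ ∑ τ
  ∑-U τ = +-cancelʳ-≡ (r τ * N) (∑ (U τ)) (∑ τ) (begin
    ∑ (U τ) + r τ * N                       ≡⟨ cong (λ k → ∑ (U τ) + k * N) (r≡∑firing τ) ⟩
    ∑ (U τ) + ∑ (firing τ) * N              ≡⟨ cong (∑ (U τ) +_) (∑-*ʳ (firing τ) N) ⟨
    ∑ (U τ) + ∑ (λ v → firing τ v * N)      ≡⟨ ∑-+ (U τ) _ ⟨
    ∑ (λ v → U τ v + firing τ v * N)        ≡⟨ ∑-cong (U-firing τ) ⟩
    ∑ (λ v → τ v + r τ)                     ≡⟨ ∑-+ τ _ ⟩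
    ∑ τ + ∑ {N} (λ _ → r τ)                 ≡⟨ cong (∑ τ +_) (∑-const N (r τ)) ⟩
    ∑ τ + N * r τ                           ≡⟨ cong (∑ τ +_) (*-comm N (r τ)) ⟩
    ∑ τ + r τ * N                           ∎)
    where open ≡-Reasoning

  U-fixed : (τ : Config N) → ¬ r τ < N → U τ ≗ τ
  U-fixed τ r≮N v with N ≤? τ v
  ... | yes N≤τv = trans (cong (τ v ∸ N +_) (≤-antisym (r≤N τ) (≮⇒≥ r≮N))) (m∸n+n≡m N≤τv)
  ... | no N≰τv  = contradiction (r<N τ v (≰⇒> N≰τv)) r≮N

  U-decreases-or-small : (τ : Config N) → r τ < N → ∀ v → U τ v < τ v ⊎ U τ v < N + N
  U-decreases-or-small τ r<N v with N ≤? τ v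
  ... | yes N≤τv = inj₁ (subst (τ v ∸ N + r τ <_) (m∸n+n≡m N≤τv) (+-monoʳ-< (τ v ∸ N) r<N))
  ... | no N≰τv  = inj₂ (+-mono-< (≰⇒> N≰τv) r<N)

  iter-+ : ∀ a b (τ : Config N) → iter (a + b) τ ≡ iter a (iter b τ)
  iter-+ zero    b τ = refl
  iter-+ (suc a) b τ = cong U (iter-+ a b τ)

  iter-U : ∀ t (τ : Config N) → iter t (U τ) ≡ U (iter t τ)
  iter-U zero    τ = refl
  iter-U (suc t) τ = cong U (iter-U t τ)

  iter-cong : ∀ t {τ τ′ : Config N} → τ ≗ τ′ → iter t τ ≗ iter t τ′
  iter-cong zero    τ≗τ′ = τ≗τ′
  iter-cong (suc t) τ≗τ′ = U-cong (iter-cong t τ≗τ′)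

  ∑-iter : ∀ t (τ : Config N) → ∑ (iter t τ) ≡ ∑ τ
  ∑-iter zero    τ = refl
  ∑-iter (suc t) τ = trans (∑-U (iter t τ)) (∑-iter t τ)

  iter-≡-mod : ∀ t (σ : Config N) → ∃ λ R → ∀ v → iter t σ v ≡ σ v + R mod N
  iter-≡-mod zero    σ = 0 , λ v → ≡⇒≡-mod (sym (+-identityʳ (σ v)))
  iter-≡-mod (suc t) σ with R , σₜ≡σ+R ← iter-≡-mod t σ = R + r σₜ , λ v → begin
      U σₜ v            ≈⟨ U-≡-mod σₜ v ⟩
      σₜ v + r σₜ       ≈⟨ +-congʳ-≡-mod (r σₜ) (σₜ≡σ+R v) ⟩
      σ v + R + r σₜ    ≡⟨ +-assoc (σ v) R (r σₜ) ⟩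
      σ v + (R + r σₜ)  ∎
    where
    open ≡-mod-Reasoning N
    σₜ : Config N
    σₜ = iter t σ

  Periodic : ℕ → Config N → Set
  Periodic m τ = iter m τ ≗ τ

  Bounded : Config N → Set
  Bounded τ = ∀ v → τ v < N + N

  Spread : Config N → Set
  Spread τ = ∀ v w → τ v < τ w + N

  U-window : (τ : Config N) → Bounded τ → ∀ v → r τ ≤ U τ v × U τ v < r τ + N
  U-window τ bounded v with N ≤? τ v
  ... | yes N≤τv = m≤n+m (r τ) (τ v ∸ N) , subst (_< r τ + N) (+-comm (r τ) (τ v ∸ N)) (+-monoʳ-< (r τ) τv∸N<N)
    where
    τv∸N<N : τ v ∸ N < N
    τv∸N<N = +-cancelʳ-< N (τ v ∸ N) N (subst (_< N + N) (sym (m∸n+n≡m N≤τv)) (bounded v))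
  ... | no N≰τv  = m≤n+m (r τ) (τ v) , subst (_< r τ + N) (+-comm (r τ) (τ v)) (+-monoʳ-< (r τ) (≰⇒> N≰τv))

  U-bounded : (τ : Config N) → Bounded τ → Bounded (U τ)
  U-bounded τ bounded v = <-≤-trans (proj₂ (U-window τ bounded v)) (+-monoˡ-≤ N (r≤N τ))

  U-spread : (τ : Config N) → Bounded τ → Spread (U τ)
  U-spread τ bounded v w = <-≤-trans (proj₂ (U-window τ bounded v)) (+-monoˡ-≤ N (proj₁ (U-window τ bounded w)))

  iter-bounded : ∀ t {τ : Config N} → Bounded τ → Bounded (iter t τ)
  iter-bounded zero    bounded = bounded
  iter-bounded (suc t) bounded = U-bounded _ (iter-bounded t bounded)

  overflow : Config N → ℕ
  overflow τ = ∑ (λ v → excess (N + N) (τ v))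

  overflow-U : (τ : Config N) → r τ < N → ∀ v → N + N ≤ τ v → overflow (U τ) < overflow τ
  overflow-U τ r<N v N+N≤τv =
    ∑-mono-< (λ w → excess-mono-≤ (U-decreases-or-small τ r<N w)) v (excess-mono-< Uτv<τv N+N≤τv)
    where
    Uτv<τv : U τ v < τ v
    Uτv<τv = Sum.[ id , (λ Uτv<N+N → <-≤-trans Uτv<N+N N+N≤τv) ] (U-decreases-or-small τ r<N v)

  eventually-fixed-or-bounded : (τ : Config N) →
    (∃ λ T → Periodic 1 (iter T τ)) ⊎ (∃ λ T → Bounded (iter T τ))
  eventually-fixed-or-bounded τ = descend (suc (overflow τ)) τ ≤-refl
    where
    descend : ∀ k (τ : Config N) → overflow τ < k →
      (∃ λ T → Periodic 1 (iter T τ)) ⊎ (∃ λ T → Bounded (iter T τ))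
    descend zero    τ ()
    descend (suc k) τ overflow<1+k with Fin.any? (λ v → N + N ≤? τ v) | r τ <? N
    ... | no none        | _       = inj₂ (0 , λ v → ≰⇒> (λ N+N≤τv → none (v , N+N≤τv)))
    ... | yes _          | no r≮N  = inj₁ (0 , U-fixed τ r≮N)
    ... | yes (v , N+N≤τv) | yes r<N =
      Sum.map (later {Periodic 1}) (later {Bounded})
        (descend k (U τ) (<-≤-trans (overflow-U τ r<N v N+N≤τv) (≤-pred overflow<1+k)))
      where
      later : ∀ {P : Config N → Set} → (∃ λ T → P (iter T (U τ))) → ∃ λ T → P (iter T τ)
      later {P} (T , P[σₜ]) = suc T , subst P (iter-U T τ) P[σₜ]

  IsMinimum : Config N → Fin N → Set
  IsMinimum τ u = ∀ w → τ u ≤ τ w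

  offset-≡-mod : ∀ {σ τ : Config N} {R} → (∀ v → τ v ≡ σ v + R mod N) →
                 ∀ {u x} → τ u ≤ τ x → τ x ∸ τ u + σ u ≡ σ x mod N
  offset-≡-mod {σ} {τ} {R} τ≡σ+R {u} {x} τu≤τx = +-cancelʳ-≡-mod R (begin
    τ x ∸ τ u + σ u + R      ≡⟨ +-assoc (τ x ∸ τ u) (σ u) R ⟩
    τ x ∸ τ u + (σ u + R)    ≈⟨ +-congˡ-≡-mod (τ x ∸ τ u) (τ≡σ+R u) ⟨
    τ x ∸ τ u + τ u          ≡⟨ m∸n+n≡m τu≤τx ⟩
    τ x                      ≈⟨ τ≡σ+R x ⟩
    σ x + R                  ∎)
    where open ≡-mod-Reasoning N

  ∑-offset : ∀ {τ : Config N} {u} → IsMinimum τ u → ∑ τ ≡ N * τ u + ∑ (λ x → τ x ∸ τ u)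
  ∑-offset {τ} {u} u-minimal = begin
    ∑ τ                                       ≡⟨ ∑-cong (λ x → m+[n∸m]≡n (u-minimal x)) ⟨
    ∑ (λ x → τ u + (τ x ∸ τ u))               ≡⟨ ∑-+ (λ _ → τ u) (λ x → τ x ∸ τ u) ⟩
    ∑ {N} (λ _ → τ u) + ∑ (λ x → τ x ∸ τ u)   ≡⟨ cong (_+ ∑ (λ x → τ x ∸ τ u)) (∑-const N (τ u)) ⟩
    N * τ u + ∑ (λ x → τ x ∸ τ u)             ∎
    where open ≡-Reasoning

  module _ .{{_ : NonZero N}} where

    offsets-agree : ∀ {σ τ τ′ : Config N} {R R′} →
                    (∀ v → τ v ≡ σ v + R mod N) → (∀ v → τ′ v ≡ σ v + R′ mod N) →
                    Spread τ → Spread τ′ → ∀ {u u′} → IsMinimum τ u → IsMinimum τ′ u′ →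
                    σ u ≡ σ u′ → ∀ x → τ x ∸ τ u ≡ τ′ x ∸ τ′ u′
    offsets-agree {σ} {τ} {τ′} τ≡σ+R τ′≡σ+R′ spread spread′ {u} {u′} u-minimal u′-minimal σu≡σu′ x =
      ≡-mod⇒≡ (m<n+o⇒m∸n<o (τ x) (τ u) (spread x u)) (m<n+o⇒m∸n<o (τ′ x) (τ′ u′) (spread′ x u′))
        (+-cancelʳ-≡-mod (σ u) (begin
          τ x ∸ τ u + σ u       ≈⟨ offset-≡-mod τ≡σ+R (u-minimal x) ⟩
          σ x                   ≈⟨ offset-≡-mod τ′≡σ+R′ (u′-minimal x) ⟨
          τ′ x ∸ τ′ u′ + σ u′   ≡⟨ cong (τ′ x ∸ τ′ u′ +_) σu≡σu′ ⟨
          τ′ x ∸ τ′ u′ + σ u    ∎))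
      where open ≡-mod-Reasoning N

    offsets-and-sum-determine : ∀ {τ τ′ : Config N} {u u′} → IsMinimum τ u → IsMinimum τ′ u′ →
                                (∀ x → τ x ∸ τ u ≡ τ′ x ∸ τ′ u′) → ∑ τ ≡ ∑ τ′ → τ ≗ τ′
    offsets-and-sum-determine {τ} {τ′} {u} {u′} u-minimal u′-minimal offsets ∑τ≡∑τ′ x = begin
      τ x                    ≡⟨ m+[n∸m]≡n (u-minimal x) ⟨
      τ u + (τ x ∸ τ u)      ≡⟨ cong₂ _+_ τu≡τ′u′ (offsets x) ⟩
      τ′ u′ + (τ′ x ∸ τ′ u′) ≡⟨ m+[n∸m]≡n (u′-minimal x) ⟩
      τ′ x                   ∎
      where
      open ≡-Reasoning
      τu≡τ′u′ : τ u ≡ τ′ u′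
      τu≡τ′u′ = *-cancelˡ-≡ (τ u) (τ′ u′) N (+-cancelʳ-≡ _ _ _ (begin
        N * τ u + ∑ (λ x → τ x ∸ τ u)        ≡⟨ ∑-offset u-minimal ⟨
        ∑ τ                                  ≡⟨ ∑τ≡∑τ′ ⟩
        ∑ τ′                                 ≡⟨ ∑-offset u′-minimal ⟩
        N * τ′ u′ + ∑ (λ x → τ′ x ∸ τ′ u′)   ≡⟨ cong (N * τ′ u′ +_) (∑-cong offsets) ⟨
        N * τ′ u′ + ∑ (λ x → τ x ∸ τ u)      ∎))

    orbit-determined-by-minimum : (σ : Config N) {t t′ : ℕ} {u u′ : Fin N} →
      Spread (iter t σ) → Spread (iter t′ σ) → IsMinimum (iter t σ) u → IsMinimum (iter t′ σ) u′ →
      σ u ≡ σ u′ → iter t σ ≗ iter t′ σ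
    orbit-determined-by-minimum σ {t} {t′} spread spread′ u-minimal u′-minimal σu≡σu′
      with R , σₜ≡σ+R ← iter-≡-mod t σ | R′ , σₜ′≡σ+R′ ← iter-≡-mod t′ σ =
      offsets-and-sum-determine u-minimal u′-minimal
        (offsets-agree σₜ≡σ+R σₜ′≡σ+R′ spread spread′ u-minimal u′-minimal σu≡σu′)
        (trans (∑-iter t σ) (sym (∑-iter t′ σ)))

  iter-comm : ∀ a b (τ : Config N) → iter a (iter b τ) ≡ iter b (iter a τ)
  iter-comm a b τ = trans (sym (iter-+ a b τ)) (trans (cong (λ s → iter s τ) (+-comm a b)) (iter-+ b a τ))

  iter-+ʳ : ∀ t m (σ : Config N) → iter (t + m) σ ≡ iter m (iter t σ)
  iter-+ʳ t m σ = trans (cong (λ s → iter s σ) (+-comm t m)) (iter-+ m t σ)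

  periodic-iter : ∀ {m} {τ : Config N} → Periodic m τ → ∀ k → Periodic m (iter k τ)
  periodic-iter {m} {τ} periodic k v = trans (cong-app (iter-comm m k τ) v) (iter-cong k periodic v)

  periodic-multiple : ∀ {p} {τ : Config N} → Periodic p τ → ∀ k → Periodic (k * p) τ
  periodic-multiple         periodic zero    v = refl
  periodic-multiple {p} {τ} periodic (suc k) v = begin
    iter (p + k * p) τ v       ≡⟨ cong-app (iter-+ p (k * p) τ) v ⟩
    iter p (iter (k * p) τ) v  ≡⟨ iter-cong p (periodic-multiple periodic k) v ⟩
    iter p τ v                 ≡⟨ periodic v ⟩
    τ v                        ∎
    where open ≡-Reasoning

  periodic-from : ∀ {m t₀ t} {σ : Config N} → Periodic m (iter t₀ σ) → t₀ ≤ t → Periodic m (iter t σ)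
  periodic-from {m} {t₀} {t} {σ} periodic t₀≤t =
    subst (Periodic m) (trans (sym (iter-+ (t ∸ t₀) t₀ σ)) (cong (λ s → iter s σ) (m∸n+n≡m t₀≤t)))
      (periodic-iter {m} periodic (t ∸ t₀))

  periodic⇒eventuallyPeriodic : ∀ {m t₀} {σ : Config N} → Periodic m (iter t₀ σ) → EventuallyPeriodicWith σ m
  periodic⇒eventuallyPeriodic {m} {t₀} {σ} periodic =
    t₀ , λ t t₀≤t v → trans (cong-app (iter-+ʳ t m σ) v) (periodic-from {m} {t₀} periodic t₀≤t v)

  eventuallyPeriodic⇒periodic : ∀ {p m t₀} {σ : Config N} → 1 ≤ p → Periodic p (iter t₀ σ) →
                                EventuallyPeriodicWith σ m → Periodic m (iter t₀ σ)
  eventuallyPeriodic⇒periodic {p@(suc _)} {m} {t₀} {σ} _ periodic (t₁ , periodic-after-t₁) v = begin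
    iter m τ v            ≡⟨ iter-cong m (sym ∘ σₜ≗τ) v ⟩
    iter m (iter t σ) v   ≡⟨ cong-app (iter-+ʳ t m σ) v ⟨
    iter (t + m) σ v      ≡⟨ periodic-after-t₁ t (≤-trans (m≤m*n t₁ p) (m≤m+n (t₁ * p) t₀)) v ⟩
    iter t σ v            ≡⟨ σₜ≗τ v ⟩
    τ v                   ∎
    where
    open ≡-Reasoning
    τ : Config N
    τ = iter t₀ σ
    t : ℕ
    t = t₁ * p + t₀
    σₜ≗τ : iter t σ ≗ τ
    σₜ≗τ w = trans (cong-app (iter-+ (t₁ * p) t₀ σ) w) (periodic-multiple periodic t₁ w)

  least-period : ∀ {p t₀} {σ : Config N} → 1 ≤ p → Periodic p (iter t₀ σ) →
                 ∃ λ m → IsEventualPeriod σ m × m ≤ p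
  least-period {p} {t₀} {σ} 1≤p periodic
    with least (λ m → 1 ≤? m ×-dec Fin.all? (λ v → iter m (iter t₀ σ) v ≟ iter t₀ σ v)) (1≤p , periodic)
  ... | m , (1≤m , periodicₘ) , minimal =
    m , (1≤m , periodic⇒eventuallyPeriodic {m} {t₀} periodicₘ , below) , minimal (1≤p , periodic)
    where
    below : ∀ m′ → 1 ≤ m′ → EventuallyPeriodicWith σ m′ → m ≤ m′
    below m′ 1≤m′ eventuallyPeriodic =
      minimal (1≤m′ , eventuallyPeriodic⇒periodic {p} {m′} {t₀} 1≤p periodic eventuallyPeriodic)

∈-heights : ∀ {N} (σ : Config N) v → σ v ∈ deduplicate _≟_ (map σ (allFinL N))
∈-heights σ v = ∈-deduplicate⁺ _≟_ (∈-map⁺ σ (∈-allFin v))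

height-index : ∀ {N} (σ : Config N) → Fin N → Fin (ν σ)
height-index σ v = Any.index (∈-heights σ v)

height-index-sound : ∀ {N} (σ : Config N) {v w} → height-index σ v ≡ height-index σ w → σ v ≡ σ w
height-index-sound {N} σ {v} {w} same = begin
  σ v                                          ≡⟨ lookup-index (∈-heights σ v) ⟩
  lookup heights (height-index σ v)            ≡⟨ cong (lookup heights) same ⟩
  lookup heights (height-index σ w)            ≡⟨ lookup-index (∈-heights σ w) ⟨
  σ w                                          ∎
  where
  open ≡-Reasoning
  heights : List ℕ
  heights = deduplicate _≟_ (map σ (allFinL N))

ν-positive : ∀ {n} (σ : Config (suc n)) → 1 ≤ ν σ
ν-positive σ = >-nonZero⁻¹ (ν σ) {{Fin.nonZeroIndex (height-index σ fzero)}}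

heights-repeat : ∀ {N} (σ : Config N) (f : ℕ → Fin N) → ∃₂ λ i j → i < j × j ≤ ν σ × σ (f i) ≡ σ (f j)
heights-repeat σ f with Fin.pigeonhole (n<1+n (ν σ)) (height-index σ ∘ f ∘ toℕ)
... | i , j , i<j , same = toℕ i , toℕ j , i<j , ≤-pred (Fin.toℕ<n j) , height-index-sound σ same

minimal-vertex : ∀ {n} → Config (suc n) → Fin (suc n)
minimal-vertex {n} τ = argmin τ fzero (allFinL (suc n))

minimal-vertex-isMinimum : ∀ {n} (τ : Config (suc n)) → IsMinimum τ (minimal-vertex τ)
minimal-vertex-isMinimum {n} τ w = All.lookup (f[argmin]≤f[xs] {f = τ} fzero (allFinL (suc n))) (∈-allFin w)

bounded⇒periodic : ∀ {n} (σ : Config (suc n)) {T} → Bounded (iter T σ) →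
                   ∃₂ λ t₀ p → 1 ≤ p × p ≤ ν σ × Periodic p (iter t₀ σ)
-- The repetition is taken apart by a helper rather than by `with`, whose abstraction
-- would normalise the iterates of U.
bounded⇒periodic {n} σ {T} bounded = from-repetition (heights-repeat σ (minimal-vertex ∘ σₜ))
  where
  open ≡-Reasoning
  σₜ : ℕ → Config (suc n)
  σₜ k = iter (suc (k + T)) σ
  spread : ∀ k → Spread (σₜ k)
  spread k = U-spread (iter (k + T) σ) (subst Bounded (sym (iter-+ k T σ)) (iter-bounded k bounded))
  elapsed : ∀ {i j} → i ≤ j → j ∸ i + suc (i + T) ≡ suc (j + T)
  elapsed {i} {j} i≤j = begin
    j ∸ i + suc (i + T)    ≡⟨ +-suc (j ∸ i) (i + T) ⟩
    suc (j ∸ i + (i + T))  ≡⟨ cong suc (+-assoc (j ∸ i) i T) ⟨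
    suc (j ∸ i + i + T)    ≡⟨ cong (λ k → suc (k + T)) (m∸n+n≡m i≤j) ⟩
    suc (j + T)            ∎
  from-repetition : (∃₂ λ i j → i < j × j ≤ ν σ × σ (minimal-vertex (σₜ i)) ≡ σ (minimal-vertex (σₜ j))) →
                    ∃₂ λ t₀ p → 1 ≤ p × p ≤ ν σ × Periodic p (iter t₀ σ)
  from-repetition (i , j , i<j , j≤ν , same-height) =
    suc (i + T) , j ∸ i , m<n⇒0<n∸m i<j , ≤-trans (m∸n≤m j i) j≤ν , λ v → begin
      iter (j ∸ i) (σₜ i) v           ≡⟨ cong-app (iter-+ (j ∸ i) (suc (i + T)) σ) v ⟨
      iter (j ∸ i + suc (i + T)) σ v  ≡⟨ cong (λ s → iter s σ v) (elapsed (<⇒≤ i<j)) ⟩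
      σₜ j v                          ≡⟨ σₜi≗σₜj v ⟨
      σₜ i v                          ∎
    where
    σₜi≗σₜj : σₜ i ≗ σₜ j
    σₜi≗σₜj = orbit-determined-by-minimum σ {suc (i + T)} {suc (j + T)} (spread i) (spread j)
                (minimal-vertex-isMinimum (σₜ i)) (minimal-vertex-isMinimum (σₜ j)) same-height

periodic-within-ν : ∀ {n} (σ : Config (suc n)) → ∃₂ λ t₀ p → 1 ≤ p × p ≤ ν σ × Periodic p (iter t₀ σ)
periodic-within-ν σ with eventually-fixed-or-bounded σ
... | inj₁ (T , fixed)   = T , 1 , ≤-refl , ν-positive σ , fixed
... | inj₂ (T , bounded) = bounded⇒periodic σ {T} bounded

proposition4p6 : (n : ℕ) → (σ : Config (suc n)) →
    ∃ λ m → IsEventualPeriod σ m × (m ≤ ν σ)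
proposition4p6 n σ with periodic-within-ν σ
... | t₀ , p , 1≤p , p≤ν , periodic with least-period {p = p} {t₀ = t₀} 1≤p periodic
...   | m , isEventualPeriod , m≤p = m , isEventualPeriod , ≤-trans m≤p p≤ν
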